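{- Let $\Sigma$ be a finite alphabet and let $R$ be a convergent and forward-closed string rewriting system over $\Sigma$. Let $l \to r$ be a rule in $R$, and let $\rho_R(r)$ denote the $R$-normal form of $r$. Then the system $R' = \left(R \setminus \{l \to r\}\right) \cup \{l \to \rho_R(r)\}$ is convergent, forward-closed, and equivalent to $R$, i.e. $\leftrightarrow_R^* \,=\, \leftrightarrow_{R'}^*$.
   Context: A string rewriting system (SRS) $R$ over $\Sigma$ is a set of rules $l \to r$ with $l, r \in \Sigma^*$; the rewrite relation is $\to_R = \{(xly, xry) : x,y \in \Sigma^*, (l \to r) \in R\}$, $\to_R^*$ its reflexive-transitive closure and $\leftrightarrow_R^*$ the generated equivalence. $R$ is convergent if it is terminating and confluent; the normal form of a string is the unique irreducible string it reduces to. A string of the form $wl$ with $w \in \Sigma^*$ and $l$ a left-hand side of $R$ is a redex; a redex is innermost if no proper prefix of it is a redex. $R$ is forward-closed if every innermost redex can be reduced to its normal form in one rewrite step. -}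

module Defs where

open import Data.Nat using (ℕ)
open import Data.Fin using (Fin)
open import Data.List using (List; []; _++_)
open import Data.Product using (_×_; _,_; ∃; ∃-syntax; Σ-syntax)
open import Data.Sum using (_⊎_)
open import Relation.Nullary using (¬_)
open import Relation.Binary.PropositionalEquality using (_≡_; _≢_)
open import Relation.Binary.Construct.Closure.ReflexiveTransitive using (Star)
open import Relation.Binary.Construct.Closure.Equivalence using (EqClosure)
open import Induction.WellFounded using (WellFounded)

Word : ℕ → Set
Word k = List (Fin k)

Rule : ℕ → Set
Rule k = Word k × Word k

SRS : ℕ → Set₁
SRS k = Rule k → Set

module _ {k : ℕ} where

  Step : SRS k → Word k → Word k → Set
  Step R u v = ∃[ x ] ∃[ y ] ∃[ l ] ∃[ r ]
    (R (l , r) × u ≡ x ++ l ++ y × v ≡ x ++ r ++ y)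

  Steps : SRS k → Word k → Word k → Set
  Steps R = Star (Step R)

  Equiv : SRS k → Word k → Word k → Set
  Equiv R = EqClosure (Step R)

  Irreducible : SRS k → Word k → Set
  Irreducible R u = ∀ v → ¬ Step R u v

  NormalFormOf : SRS k → Word k → Word k → Set
  NormalFormOf R u nf = Steps R u nf × Irreducible R nf

  Terminating : SRS k → Set
  Terminating R = WellFounded (λ v u → Step R u v)

  Confluent : SRS k → Set
  Confluent R = ∀ u v w → Steps R u v → Steps R u w →
    ∃[ z ] (Steps R v z × Steps R w z)

  Convergent : SRS k → Set
  Convergent R = Terminating R × Confluent R

  Redex : SRS k → Word k → Set
  Redex R u = ∃[ w ] ∃[ l ] ∃[ r ] (R (l , r) × u ≡ w ++ l)

  InnermostRedex : SRS k → Word k → Set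
  InnermostRedex R u = Redex R u ×
    (∀ p s → u ≡ p ++ s → s ≢ [] → ¬ Redex R p)

  ForwardClosed : SRS k → Set
  ForwardClosed R = ∀ u → InnermostRedex R u →
    ∃[ v ] (Step R u v × NormalFormOf R u v)

  Replace : SRS k → Word k → Word k → Word k → SRS k
  Replace R l r nf rule = (R rule × rule ≢ (l , r)) ⊎ rule ≡ (l , nf)

-- Every R′-step is a non-empty R-reduction, so R′ terminates and its equivalence lies inside
-- that of R.  Conversely every R-step u ⟶ v is simulated by an R′-step u ⟶′ w with v ⟶* w.
-- By well-founded induction along R⁺ one shows simultaneously that every R-reduct of u is
-- R′-joinable with u and that R′ is confluent at u; this gives confluence of R′ and the
-- reverse inclusion of equivalences.  For forward-closure: if a redex is normalised in one
-- step by l → r, the irreducible contractum x r y forces r = nf, so the step is an R′-step.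
module Submission where

open import Defs
open import Data.Nat using (ℕ)
open import Data.Fin using () renaming (_≟_ to _≟ᶠ_)
open import Data.List using (_++_)
open import Data.List.Properties using (++-assoc) renaming (≡-dec to ≡-decᴸ)
open import Data.Product using (_×_; _,_; proj₁; proj₂; ∃-syntax)
open import Data.Product.Properties using () renaming (≡-dec to ≡-decᴾ)
open import Data.Sum using (_⊎_; inj₁; inj₂)
open import Data.Empty using (⊥-elim)
open import Function using (flip; _∘_)
open import Function.Bundles using (_⇔_; mk⇔)
open import Induction.WellFounded using (WellFounded; WfRec; module All; module Subrelation)
open import Relation.Nullary using (yes; no)
open import Relation.Binary.Core using (Rel)
open import Relation.Binary.PropositionalEquality using (_≡_; refl; cong; module ≡-Reasoning)
open import Relation.Binary.Rewriting using (StronglyNormalizing) renaming (Confluent to Confluentᴬ)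
open import Relation.Binary.Construct.Closure.ReflexiveTransitive using (Star; ε; _◅_; _◅◅_; gmap)
open import Relation.Binary.Construct.Closure.Equivalence using (EqClosure; fold; isEquivalence)
open import Relation.Binary.Construct.Closure.Equivalence.Properties using (a—↠b⇒a↔b; a—↠b⇒b↔a)
open import Relation.Binary.Construct.Closure.Transitive using (TransClosure; [_]; _∷ʳ_)
import Relation.Binary.Construct.Closure.Transitive as Transitive

module Simulation {a ℓ ℓ′} {A : Set a} {_⟶_ : Rel A ℓ} {_⟶′_ : Rel A ℓ′}
  (⟶-stronglyNormalizing : StronglyNormalizing _⟶_)
  (⟶-confluent : Confluentᴬ _⟶_)
  (⟶′⊆⟶⁺ : ∀ {u v} → u ⟶′ v → ∃[ w ] (u ⟶ w × Star _⟶_ w v))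
  (⟶⊆⟶′⟵* : ∀ {u v} → u ⟶ v → ∃[ w ] (u ⟶′ w × Star _⟶_ v w))
  where

  private
    _⟶*_ = Star _⟶_
    _⟶′*_ = Star _⟶′_

    _≺_ : Rel A _
    _≺_ = TransClosure (flip _⟶_)

  ≺-wellFounded : WellFounded _≺_
  ≺-wellFounded = Transitive.wellFounded _ ⟶-stronglyNormalizing

  ⟶◅⟶*⇒≺ : ∀ {u w v} → u ⟶ w → w ⟶* v → v ≺ u
  ⟶◅⟶*⇒≺ u⟶w ε = [ u⟶w ]
  ⟶◅⟶*⇒≺ u⟶w (w⟶w′ ◅ w′⟶*v) = ⟶◅⟶*⇒≺ w⟶w′ w′⟶*v ∷ʳ u⟶w

  ⟶′◅⟶*⇒≺ : ∀ {u w v} → u ⟶′ w → w ⟶* v → v ≺ u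
  ⟶′◅⟶*⇒≺ u⟶′w w⟶*v =
    let _ , u⟶x , x⟶*w = ⟶′⊆⟶⁺ u⟶′w in ⟶◅⟶*⇒≺ u⟶x (x⟶*w ◅◅ w⟶*v)

  ⟶′*⇒⟶* : ∀ {u v} → u ⟶′* v → u ⟶* v
  ⟶′*⇒⟶* ε = ε
  ⟶′*⇒⟶* (u⟶′w ◅ w⟶′*v) =
    let _ , u⟶x , x⟶*w = ⟶′⊆⟶⁺ u⟶′w in u⟶x ◅ x⟶*w ◅◅ ⟶′*⇒⟶* w⟶′*v

  Joinable′ : A → A → Set _
  Joinable′ u v = ∃[ t ] (u ⟶′* t × v ⟶′* t)

  ReductsJoinable′ : A → Set _
  ReductsJoinable′ u = ∀ {z} → u ⟶* z → Joinable′ u z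

  Confluent′At : A → Set _
  Confluent′At u = ∀ {v w} → u ⟶′* v → u ⟶′* w → Joinable′ v w

  JoinableAndConfluent′ : A → Set _
  JoinableAndConfluent′ u = ReductsJoinable′ u × Confluent′At u

  reductsJoinable′ : ∀ {u} → WfRec _≺_ JoinableAndConfluent′ u → ReductsJoinable′ u
  reductsJoinable′ ih ε = _ , ε , ε
  reductsJoinable′ ih (u⟶b ◅ b⟶*z) =
    let c , u⟶′c , b⟶*c = ⟶⊆⟶′⟵* u⟶b
        joinsᵇ , confᵇ = ih [ u⟶b ]
        t₁ , b⟶′*t₁ , z⟶′*t₁ = joinsᵇ b⟶*z
        t₂ , b⟶′*t₂ , c⟶′*t₂ = joinsᵇ b⟶*c
        t , t₁⟶′*t , t₂⟶′*t = confᵇ b⟶′*t₁ b⟶′*t₂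
    in t , u⟶′c ◅ c⟶′*t₂ ◅◅ t₂⟶′*t , z⟶′*t₁ ◅◅ t₁⟶′*t

  -- Join the two R′-branches in R at z, bring z back to R′ on both sides, and close the
  -- resulting diagram by R′-confluence at b, c and z, all of which lie strictly below u.
  confluent′At : ∀ {u} → WfRec _≺_ JoinableAndConfluent′ u → Confluent′At u
  confluent′At ih ε u⟶′*w = _ , u⟶′*w , ε
  confluent′At ih u⟶′*v@(_ ◅ _) ε = _ , ε , u⟶′*v
  confluent′At ih (u⟶′b ◅ b⟶′*v) (u⟶′c ◅ c⟶′*w) =
    let z , b⟶*z , c⟶*z = ⟶-confluent (⟶′*⇒⟶* (u⟶′b ◅ ε)) (⟶′*⇒⟶* (u⟶′c ◅ ε))
        joinsᵇ , confᵇ = ih (⟶′◅⟶*⇒≺ u⟶′b ε)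
        joinsᶜ , confᶜ = ih (⟶′◅⟶*⇒≺ u⟶′c ε)
        _ , confᶻ = ih (⟶′◅⟶*⇒≺ u⟶′b b⟶*z)
        t₁ , b⟶′*t₁ , z⟶′*t₁ = joinsᵇ b⟶*z
        t₂ , c⟶′*t₂ , z⟶′*t₂ = joinsᶜ c⟶*z
        t₃ , t₁⟶′*t₃ , t₂⟶′*t₃ = confᶻ z⟶′*t₁ z⟶′*t₂
        s₁ , v⟶′*s₁ , t₃⟶′*s₁ = confᵇ b⟶′*v (b⟶′*t₁ ◅◅ t₁⟶′*t₃)
        s , s₁⟶′*s , w⟶′*s = confᶜ (c⟶′*t₂ ◅◅ t₂⟶′*t₃ ◅◅ t₃⟶′*s₁) c⟶′*w
    in s , v⟶′*s₁ ◅◅ s₁⟶′*s , w⟶′*s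

  joinableAndConfluent′ : ∀ u → JoinableAndConfluent′ u
  joinableAndConfluent′ = All.wfRec ≺-wellFounded _ JoinableAndConfluent′
    (λ _ ih → reductsJoinable′ ih , confluent′At ih)

  ⟶′-stronglyNormalizing : StronglyNormalizing _⟶′_
  ⟶′-stronglyNormalizing =
    Subrelation.wellFounded (λ u⟶′v → ⟶′◅⟶*⇒≺ u⟶′v ε) ≺-wellFounded

  ⟶′-confluent : Confluentᴬ _⟶′_
  ⟶′-confluent {u} = proj₂ (joinableAndConfluent′ u)

  ↔⇔↔′ : ∀ {u v} → EqClosure _⟶_ u v ⇔ EqClosure _⟶′_ u v
  ↔⇔↔′ = mk⇔ (fold (isEquivalence _) ⟶⊆↔′) (fold (isEquivalence _) ⟶′⊆↔)
    where
    ⟶⊆↔′ : ∀ {u v} → u ⟶ v → EqClosure _⟶′_ u v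
    ⟶⊆↔′ {u} u⟶v =
      let _ , u⟶′*t , v⟶′*t = proj₁ (joinableAndConfluent′ u) (u⟶v ◅ ε)
      in a—↠b⇒a↔b u⟶′*t ◅◅ a—↠b⇒b↔a v⟶′*t

    ⟶′⊆↔ : ∀ {u v} → u ⟶′ v → EqClosure _⟶_ u v
    ⟶′⊆↔ u⟶′v = a—↠b⇒a↔b (⟶′*⇒⟶* (u⟶′v ◅ ε))

module _ {k : ℕ} where

  Step-++ : ∀ {S : SRS k} x y {u v} → Step S u v → Step S (x ++ u ++ y) (x ++ v ++ y)
  Step-++ x y (p , s , l , r , ρ , refl , refl) =
    x ++ p , s ++ y , l , r , ρ , reassoc l , reassoc r
    where
    reassoc : ∀ m → x ++ (p ++ m ++ s) ++ y ≡ (x ++ p) ++ m ++ (s ++ y)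
    reassoc m = begin
      x ++ (p ++ m ++ s) ++ y  ≡⟨ cong (x ++_) (++-assoc p (m ++ s) y) ⟩
      x ++ p ++ (m ++ s) ++ y  ≡⟨ cong (λ t → x ++ p ++ t) (++-assoc m s y) ⟩
      x ++ p ++ m ++ s ++ y    ≡⟨ ++-assoc x p (m ++ s ++ y) ⟨
      (x ++ p) ++ m ++ s ++ y  ∎
      where open ≡-Reasoning

  Steps-++ : ∀ {S : SRS k} x y {u v} → Steps S u v → Steps S (x ++ u ++ y) (x ++ v ++ y)
  Steps-++ x y = gmap (λ w → x ++ w ++ y) (Step-++ x y)

  Irreducible-infix : ∀ {S : SRS k} x y {u} → Irreducible S (x ++ u ++ y) → Irreducible S u
  Irreducible-infix x y irr v u⟶v = irr _ (Step-++ x y u⟶v)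

  Irreducible-Steps⇒≡ : ∀ {S : SRS k} {u v} → Irreducible S u → Steps S u v → u ≡ v
  Irreducible-Steps⇒≡ irr ε = refl
  Irreducible-Steps⇒≡ irr (u⟶w ◅ _) = ⊥-elim (irr _ u⟶w)

  module Replacement (R : SRS k) {l r nf : Word k} (lr∈R : R (l , r)) (r⟶*nf : Steps R r nf)
    where

    private
      R′ : SRS k
      R′ = Replace R l r nf

    kept-or-replaced : ∀ {ρ} → R ρ → R′ ρ ⊎ ρ ≡ (l , r)
    kept-or-replaced {ρ} ρ∈R with ≡-decᴾ (≡-decᴸ _≟ᶠ_) (≡-decᴸ _≟ᶠ_) ρ (l , r)
    ... | yes ρ≡lr = inj₂ ρ≡lr
    ... | no ρ≢lr = inj₁ (inj₁ (ρ∈R , ρ≢lr))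

    Step′⊆Step⁺ : ∀ {u v} → Step R′ u v → ∃[ w ] (Step R u w × Steps R w v)
    Step′⊆Step⁺ (x , y , l′ , r′ , inj₁ (ρ∈R , _) , refl , refl) =
      _ , (x , y , l′ , r′ , ρ∈R , refl , refl) , ε
    Step′⊆Step⁺ (x , y , _ , _ , inj₂ refl , refl , refl) =
      _ , (x , y , l , r , lr∈R , refl , refl) , Steps-++ x y r⟶*nf

    Step⊆Step′⟵Steps : ∀ {u v} → Step R u v → ∃[ w ] (Step R′ u w × Steps R v w)
    Step⊆Step′⟵Steps (x , y , l′ , r′ , ρ∈R , refl , refl) with kept-or-replaced ρ∈R
    ... | inj₁ ρ∈R′ = _ , (x , y , l′ , r′ , ρ∈R′ , refl , refl) , ε
    ... | inj₂ refl = _ , (x , y , l , nf , inj₂ refl , refl , refl) , Steps-++ x y r⟶*nf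

    Irreducible⇒Irreducible′ : ∀ {u} → Irreducible R u → Irreducible R′ u
    Irreducible⇒Irreducible′ irr _ u⟶′v = irr _ (proj₁ (proj₂ (Step′⊆Step⁺ u⟶′v)))

    Redex⇒Redex′ : ∀ {u} → Redex R u → Redex R′ u
    Redex⇒Redex′ (w , l′ , r′ , ρ∈R , refl) with kept-or-replaced ρ∈R
    ... | inj₁ ρ∈R′ = w , l′ , r′ , ρ∈R′ , refl
    ... | inj₂ refl = w , l , nf , inj₂ refl , refl

    Redex′⇒Redex : ∀ {u} → Redex R′ u → Redex R u
    Redex′⇒Redex (w , l′ , r′ , inj₁ (ρ∈R , _) , refl) = w , l′ , r′ , ρ∈R , refl
    Redex′⇒Redex (w , _ , _ , inj₂ refl , refl) = w , l , r , lr∈R , refl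

    Step-to-irreducible⇒Step′ : ∀ {u v} → Step R u v → Irreducible R v → Step R′ u v
    Step-to-irreducible⇒Step′ (x , y , l′ , r′ , ρ∈R , refl , refl) irr with kept-or-replaced ρ∈R
    ... | inj₁ ρ∈R′ = x , y , l′ , r′ , ρ∈R′ , refl , refl
    ... | inj₂ refl = x , y , l , r , inj₂ (cong (l ,_) r≡nf) , refl , refl
      where
      r≡nf : r ≡ nf
      r≡nf = Irreducible-Steps⇒≡ (Irreducible-infix x y irr) r⟶*nf

    forwardClosed′ : ForwardClosed R → ForwardClosed R′
    forwardClosed′ fc u (redex , innermost) =
      let v , u⟶v , _ , v-irr =
            fc u (Redex′⇒Redex redex , λ p s u≡ps s≢[] → innermost p s u≡ps s≢[] ∘ Redex⇒Redex′)
          u⟶′v = Step-to-irreducible⇒Step′ u⟶v v-irr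
      in v , u⟶′v , u⟶′v ◅ ε , Irreducible⇒Irreducible′ v-irr

lemma1 : (k : ℕ) (R : SRS k) (l r nf : Word k) →
    Convergent R → ForwardClosed R → R (l , r) → NormalFormOf R r nf →
    Convergent (Replace R l r nf) × ForwardClosed (Replace R l r nf) ×
      (∀ u v → Equiv R u v ⇔ Equiv (Replace R l r nf) u v)
lemma1 k R l r nf (terminating , confluent) fc lr∈R (r⟶*nf , _) =
  (⟶′-stronglyNormalizing , λ _ _ _ → ⟶′-confluent) , forwardClosed′ fc , λ _ _ → ↔⇔↔′
  where
  open Replacement R lr∈R r⟶*nf
  open Simulation terminating (confluent _ _ _) Step′⊆Step⁺ Step⊆Step′⟵Steps
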